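{- Let $D\geq 3$ be an integer and let $v_0(t),\ldots,v_D(t)\in\mathbb C[t]$ be the polynomials defined by $v_0(t)=1$, $v_1(t)=t$, and $t\,v_i(t)=(D-i+1)v_{i-1}(t)+(i+1)v_{i+1}(t)$ for $i=1,2,\ldots,D-1$. Then for every integer $n$ with $0\leq n\leq D$, $$v_{D-1}(D-2n)=(-1)^n(D-2n).$$ -}

module Defs where

open import Data.Nat using (ℕ; zero; suc)
open import Data.Integer using (ℤ; +_)
open import Data.Rational using (ℚ; _/_; _*_; _-_; 1ℚ)

ι : ℤ → ℚ
ι z = z / 1

-- v D i t : the value at t of the polynomial v_i(t) attached to D, defined by
--   v_0 = 1, v_1 = t,
--   t v_{i+1} = (D - (i+1) + 1) v_i + (i+2) v_{i+2}   (i.e. the paper's recurrence at index i+1),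
-- solved for v_{i+2}.  All coefficients are rational, and evaluation at a point is
-- a ring homomorphism, so this computes exactly v_i evaluated at t.
v : ℕ → ℕ → ℚ → ℚ
v D zero t = 1ℚ
v D (suc zero) t = t
v D (suc (suc i)) t =
  ((+ 1) / suc (suc i)) * ((t * v D (suc i) t) - (ι ((+ D) Data.Integer.- (+ i)) * v D i t))

{-# OPTIONS --safe #-}
-- Write D = m + n and t = m − n = D − 2n.  The coefficients fᵢ of F = (1 + x)ᵐ (1 − x)ⁿ
-- satisfy F′ (1 − x²) = (t − D x) F, which read coefficientwise is the defining
-- recurrence of the vᵢ at t; since f₀ = 1 = v₀, we get vᵢ(t) = fᵢ.  At i = D the
-- recurrence reads (D + 1) f_{D+1} + f_{D−1} = t f_D, and f_{D+1} = 0, f_D = (−1)ⁿ.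
module Submission where

open import Data.Nat as ℕ using (ℕ; zero; suc; _<_; s≤s)
import Data.Nat.Properties as ℕ
open import Relation.Binary.PropositionalEquality
open import Defs using (ι; v)

module Coefficients where

  open import Data.Integer using (ℤ; +_; _+_; _-_; _*_; _^_; 0ℤ; 1ℤ; -1ℤ)
  import Data.Integer.Properties as ℤ
  open import Data.Integer.Tactic.RingSolver using (solve-∀)
  open ≡-Reasoning

  shift : (ℕ → ℤ) → ℕ → ℤ
  shift f zero    = 0ℤ
  shift f (suc i) = f i

  mul[1+_x] : ℤ → (ℕ → ℤ) → ℕ → ℤ
  mul[1+ s x] f i = f i + s * shift f i

  one : ℕ → ℤ
  one zero    = 1ℤ
  one (suc i) = 0ℤ

  krawtchouk : ℕ → ℕ → ℕ → ℤ
  krawtchouk m       (suc n) = mul[1+ -1ℤ x] (krawtchouk m n)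
  krawtchouk zero    zero    = one
  krawtchouk (suc m) zero    = mul[1+ 1ℤ x] (krawtchouk m zero)

  -- The paper's recurrence t vᵢ = (D − i + 1) vᵢ₋₁ + (i + 1) vᵢ₊₁, imposed for all i
  -- with v₋₁ = 0, so that i = 0 gives v₁ = t v₀.
  record Recurrence (D : ℕ) (t : ℤ) (f : ℕ → ℤ) : Set where
    field
      step : ∀ i → + suc i * f (suc i) + (+ suc D - + i) * shift f i ≡ t * f i
  open Recurrence

  VanishesAbove : ℕ → (ℕ → ℤ) → Set
  VanishesAbove d f = ∀ j → d < j → f j ≡ 0ℤ

  mul[1+x]-constant : ∀ s f → mul[1+ s x] f 0 ≡ f 0
  mul[1+x]-constant s f = trans (cong (_+_ (f 0)) (ℤ.*-zeroʳ s)) (ℤ.+-identityʳ (f 0))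

  shift-mul[1+x] : ∀ s f i → shift (mul[1+ s x] f) i ≡ mul[1+ s x] (shift f) i
  shift-mul[1+x] s f zero    = sym (trans (ℤ.+-identityˡ (s * 0ℤ)) (ℤ.*-zeroʳ s))
  shift-mul[1+x] s f (suc i) = refl

  mul[1+x]-vanishesAbove : ∀ s {d f} → VanishesAbove d f → VanishesAbove (suc d) (mul[1+ s x] f)
  mul[1+x]-vanishesAbove s {f = f} f≈0 (suc j) (s≤s d<j) = begin
    f (suc j) + s * f j ≡⟨ cong₂ (λ a b → a + s * b) (f≈0 (suc j) (ℕ.m<n⇒m<1+n d<j)) (f≈0 j d<j) ⟩
    0ℤ + s * 0ℤ         ≡⟨ ℤ.+-identityˡ (s * 0ℤ) ⟩
    s * 0ℤ              ≡⟨ ℤ.*-zeroʳ s ⟩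
    0ℤ                  ∎

  mul[1+x]-top : ∀ s {d f} → VanishesAbove d f → mul[1+ s x] f (suc d) ≡ s * f d
  mul[1+x]-top s {d} {f} f≈0 = trans (cong (_+ s * f d) (f≈0 (suc d) (ℕ.n<1+n d))) (ℤ.+-identityˡ (s * f d))

  recurrence-shift : ∀ {D t f} → Recurrence D t f →
    ∀ i → + i * f i + (+ suc (suc D) - + i) * shift (shift f) i ≡ t * shift f i
  recurrence-shift {D} {t} {f} rec zero    = zeros (f 0) (+ suc (suc D) - + 0) t
    where
    zeros : ∀ y c t → 0ℤ * y + c * 0ℤ ≡ t * 0ℤ
    zeros = solve-∀
  recurrence-shift {D} {t} {f} rec (suc i) =
    trans (cong (λ c → + suc i * f (suc i) + c * shift f i) (1+d-[1+i]≡d-i (+ suc D) (+ i))) (step rec i)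
    where
    1+d-[1+i]≡d-i : ∀ d i → 1ℤ + d - (1ℤ + i) ≡ d - i
    1+d-[1+i]≡d-i = solve-∀

  mul[1+x]-recurrence : ∀ {D t f} s → s * s ≡ 1ℤ → Recurrence D t f → Recurrence (suc D) (t + s) (mul[1+ s x] f)
  mul[1+x]-recurrence {D} {t} {f} s s²≡1 rec .step i = begin
    + suc i * mul[1+ s x] f (suc i) + (+ suc (suc D) - + i) * shift (mul[1+ s x] f) i
      ≡⟨ cong (λ u → + suc i * mul[1+ s x] f (suc i) + (+ suc (suc D) - + i) * u) (shift-mul[1+x] s f i) ⟩
    + suc i * (f (suc i) + s * f i) + (+ suc (suc D) - + i) * (shift f i + s * shift (shift f) i)
      ≡⟨ regroup (+ i) (+ D) s (f (suc i)) (f i) (shift f i) (shift (shift f) i) ⟩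
    (+ suc i * f (suc i) + (+ suc D - + i) * shift f i)
      + s * (+ i * f i + (+ suc (suc D) - + i) * shift (shift f) i) + s * f i + shift f i
      ≡⟨ cong₂ (λ a b → a + s * b + s * f i + shift f i) (step rec i) (recurrence-shift rec i) ⟩
    t * f i + s * (t * shift f i) + s * f i + shift f i
      ≡⟨ cong (_+_ (t * f i + s * (t * shift f i) + s * f i)) s²u≡u ⟨
    t * f i + s * (t * shift f i) + s * f i + s * s * shift f i
      ≡⟨ factor t s (f i) (shift f i) ⟩
    (t + s) * (f i + s * shift f i) ∎
    where
    s²u≡u : s * s * shift f i ≡ shift f i
    s²u≡u = trans (cong (_* shift f i) s²≡1) (ℤ.*-identityˡ (shift f i))
    regroup : ∀ i d s y₁ y₀ u w →
      (1ℤ + i) * (y₁ + s * y₀) + (+ 2 + d - i) * (u + s * w)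
        ≡ ((1ℤ + i) * y₁ + (1ℤ + d - i) * u) + s * (i * y₀ + (+ 2 + d - i) * w) + s * y₀ + u
    regroup = solve-∀
    factor : ∀ t s y u → t * y + s * (t * u) + s * y + s * s * u ≡ (t + s) * (y + s * u)
    factor = solve-∀

  recurrence-next : ∀ {D t f} → Recurrence D t f →
    ∀ i → t * f (suc i) - (+ D - + i) * f i ≡ + suc (suc i) * f (suc (suc i))
  recurrence-next {D} {t} {f} rec i = begin
    t * f (suc i) - (+ D - + i) * f i
      ≡⟨ cong (_- (+ D - + i) * f i) (step rec (suc i)) ⟨
    + suc (suc i) * f (suc (suc i)) + (+ suc D - + suc i) * f i - (+ D - + i) * f i
      ≡⟨ cancel (+ i) (+ D) (f (suc (suc i))) (f i) ⟩
    + suc (suc i) * f (suc (suc i)) ∎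
    where
    cancel : ∀ i d y x → (+ 2 + i) * y + (1ℤ + d - (1ℤ + i)) * x - (d - i) * x ≡ (+ 2 + i) * y
    cancel = solve-∀

  recurrence-first : ∀ {D t f} → Recurrence D t f → f 0 ≡ 1ℤ → f 1 ≡ t
  recurrence-first {D} {t} {f} rec f0≡1 = begin
    f 1                                 ≡⟨ drop-zero (f 1) (+ suc D - + 0) ⟨
    + 1 * f 1 + (+ suc D - + 0) * 0ℤ    ≡⟨ step rec 0 ⟩
    t * f 0                             ≡⟨ cong (t *_) f0≡1 ⟩
    t * 1ℤ                              ≡⟨ ℤ.*-identityʳ t ⟩
    t                                   ∎
    where
    drop-zero : ∀ y c → 1ℤ * y + c * 0ℤ ≡ y
    drop-zero = solve-∀

  one-recurrence : Recurrence 0 0ℤ one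
  one-recurrence .step zero          = refl
  one-recurrence .step (suc zero)    = refl
  one-recurrence .step (suc (suc i)) = zeros (+ suc (suc (suc i))) (+ 1 - + suc (suc i))
    where
    zeros : ∀ a c → a * 0ℤ + c * 0ℤ ≡ 0ℤ
    zeros = solve-∀

  krawtchouk-recurrence : ∀ m n → Recurrence (n ℕ.+ m) (+ m - + n) (krawtchouk m n)
  krawtchouk-recurrence m       (suc n) =
    subst (λ t → Recurrence (suc (n ℕ.+ m)) t (krawtchouk m (suc n))) (m-n-1≡m-[1+n] (+ m) (+ n))
      (mul[1+x]-recurrence -1ℤ refl (krawtchouk-recurrence m n))
    where
    m-n-1≡m-[1+n] : ∀ m n → m - n + -1ℤ ≡ m - (1ℤ + n)
    m-n-1≡m-[1+n] = solve-∀
  krawtchouk-recurrence zero    zero    = one-recurrence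
  krawtchouk-recurrence (suc m) zero    =
    subst (λ t → Recurrence (suc m) t (krawtchouk (suc m) zero)) (m-0+1≡1+m-0 (+ m))
      (mul[1+x]-recurrence 1ℤ refl (krawtchouk-recurrence m zero))
    where
    m-0+1≡1+m-0 : ∀ m → m - 0ℤ + 1ℤ ≡ 1ℤ + m - 0ℤ
    m-0+1≡1+m-0 = solve-∀

  krawtchouk-constant : ∀ m n → krawtchouk m n 0 ≡ 1ℤ
  krawtchouk-constant m       (suc n) = trans (mul[1+x]-constant -1ℤ (krawtchouk m n)) (krawtchouk-constant m n)
  krawtchouk-constant zero    zero    = refl
  krawtchouk-constant (suc m) zero    = trans (mul[1+x]-constant 1ℤ (krawtchouk m zero)) (krawtchouk-constant m zero)

  krawtchouk-vanishesAbove : ∀ m n → VanishesAbove (n ℕ.+ m) (krawtchouk m n)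
  krawtchouk-vanishesAbove m       (suc n) = mul[1+x]-vanishesAbove -1ℤ (krawtchouk-vanishesAbove m n)
  krawtchouk-vanishesAbove zero    zero    (suc j) _ = refl
  krawtchouk-vanishesAbove (suc m) zero    = mul[1+x]-vanishesAbove 1ℤ (krawtchouk-vanishesAbove m zero)

  krawtchouk-top : ∀ m n → krawtchouk m n (n ℕ.+ m) ≡ -1ℤ ^ n
  krawtchouk-top m       (suc n) = trans (mul[1+x]-top -1ℤ (krawtchouk-vanishesAbove m n)) (cong (-1ℤ *_) (krawtchouk-top m n))
  krawtchouk-top zero    zero    = refl
  krawtchouk-top (suc m) zero    = begin
    krawtchouk (suc m) zero (suc m) ≡⟨ mul[1+x]-top 1ℤ (krawtchouk-vanishesAbove m zero) ⟩
    1ℤ * krawtchouk m zero m        ≡⟨ ℤ.*-identityˡ _ ⟩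
    krawtchouk m zero m             ≡⟨ krawtchouk-top m zero ⟩
    1ℤ                              ∎

  recurrence-penultimate : ∀ {k t f} → Recurrence (suc k) t f → f (suc (suc k)) ≡ 0ℤ → f k ≡ t * f (suc k)
  recurrence-penultimate {k} {t} {f} rec f[k+2]≡0 = begin
    f k
      ≡⟨ drop-top (+ k) (f k) ⟨
    + suc (suc k) * 0ℤ + (+ suc (suc k) - + suc k) * f k
      ≡⟨ cong (λ a → + suc (suc k) * a + (+ suc (suc k) - + suc k) * f k) f[k+2]≡0 ⟨
    + suc (suc k) * f (suc (suc k)) + (+ suc (suc k) - + suc k) * f k
      ≡⟨ step rec (suc k) ⟩
    t * f (suc k)
      ∎
    where
    drop-top : ∀ k x → (+ 2 + k) * 0ℤ + (+ 2 + k - (1ℤ + k)) * x ≡ x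
    drop-top = solve-∀

  krawtchouk-penultimate : ∀ m n k → n ℕ.+ m ≡ suc k → krawtchouk m n k ≡ -1ℤ ^ n * (+ m - + n)
  krawtchouk-penultimate m n k n+m≡1+k = begin
    f k                    ≡⟨ recurrence-penultimate rec (krawtchouk-vanishesAbove m n (suc (suc k)) D<k+2) ⟩
    (+ m - + n) * f (suc k) ≡⟨ cong ((+ m - + n) *_) (subst (λ j → f j ≡ -1ℤ ^ n) n+m≡1+k (krawtchouk-top m n)) ⟩
    (+ m - + n) * -1ℤ ^ n  ≡⟨ ℤ.*-comm (+ m - + n) (-1ℤ ^ n) ⟩
    -1ℤ ^ n * (+ m - + n)  ∎
    where
    f = krawtchouk m n
    rec : Recurrence (suc k) (+ m - + n) f
    rec = subst (λ D → Recurrence D (+ m - + n) f) n+m≡1+k (krawtchouk-recurrence m n)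
    D<k+2 : n ℕ.+ m < suc (suc k)
    D<k+2 = subst (_< suc (suc k)) (sym n+m≡1+k) (ℕ.n<1+n (suc k))

  [n+m]-2n≡m-n : ∀ n m → + (n ℕ.+ m) - + (2 ℕ.* n) ≡ + m - + n
  [n+m]-2n≡m-n n m = identity (+ n) (+ m)
    where
    identity : ∀ n m → n + m - (n + (n + 0ℤ)) ≡ m - n
    identity = solve-∀

module Embedding where

  open import Data.Integer using (ℤ; +_; -_; _+_; _-_; _*_; 1ℤ)
  open import Data.Integer.Tactic.RingSolver using (solve-∀)
  open import Data.Rational as ℚ using (toℚᵘ)
  open import Data.Rational.Properties using (toℚᵘ-injective; toℚᵘ-fromℚᵘ; toℚᵘ-homo-*; toℚᵘ-homo-+; toℚᵘ-homo‿-)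
  open import Data.Rational.Unnormalised as ℚᵘ using (mkℚᵘ; *≡*)
  open import Data.Rational.Unnormalised.Properties using (module ≃-Reasoning; *-cong; +-cong; +-congʳ; -‿cong)
  open ≃-Reasoning

  toℚᵘ-ι : ∀ x → toℚᵘ (ι x) ℚᵘ.≃ mkℚᵘ x 0
  toℚᵘ-ι x = toℚᵘ-fromℚᵘ (mkℚᵘ x 0)

  ι-homo-* : ∀ x y → ι (x * y) ≡ ι x ℚ.* ι y
  ι-homo-* x y = toℚᵘ-injective (begin
    toℚᵘ (ι (x * y))             ≈⟨ toℚᵘ-ι (x * y) ⟩
    mkℚᵘ x 0 ℚᵘ.* mkℚᵘ y 0       ≈⟨ *-cong (toℚᵘ-ι x) (toℚᵘ-ι y) ⟨
    toℚᵘ (ι x) ℚᵘ.* toℚᵘ (ι y)   ≈⟨ toℚᵘ-homo-* (ι x) (ι y) ⟨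
    toℚᵘ (ι x ℚ.* ι y)           ∎)

  ι-homo-- : ∀ x y → ι (x - y) ≡ ι x ℚ.- ι y
  ι-homo-- x y = toℚᵘ-injective (begin
    toℚᵘ (ι (x - y))                   ≈⟨ toℚᵘ-ι (x - y) ⟩
    mkℚᵘ (x - y) 0                     ≈⟨ *≡* (cross x y) ⟩
    mkℚᵘ x 0 ℚᵘ.- mkℚᵘ y 0             ≈⟨ +-cong (toℚᵘ-ι x) (-‿cong (toℚᵘ-ι y)) ⟨
    toℚᵘ (ι x) ℚᵘ.- toℚᵘ (ι y)         ≈⟨ +-congʳ (toℚᵘ (ι x)) (toℚᵘ-homo‿- (ι y)) ⟨
    toℚᵘ (ι x) ℚᵘ.+ toℚᵘ (ℚ.- ι y)     ≈⟨ toℚᵘ-homo-+ (ι x) (ℚ.- ι y) ⟨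
    toℚᵘ (ι x ℚ.- ι y)                 ∎)
    where
    cross : ∀ x y → (x - y) * 1ℤ ≡ (x * 1ℤ + - y * 1ℤ) * 1ℤ
    cross = solve-∀

  1/n*ι[n*x]≡ιx : ∀ k x → (+ 1 ℚ./ suc k) ℚ.* ι (+ suc k * x) ≡ ι x
  1/n*ι[n*x]≡ιx k x = toℚᵘ-injective (begin
    toℚᵘ ((+ 1 ℚ./ suc k) ℚ.* ι (+ suc k * x))               ≈⟨ toℚᵘ-homo-* (+ 1 ℚ./ suc k) (ι (+ suc k * x)) ⟩
    toℚᵘ (+ 1 ℚ./ suc k) ℚᵘ.* toℚᵘ (ι (+ suc k * x))          ≈⟨ *-cong (toℚᵘ-fromℚᵘ (mkℚᵘ (+ 1) k)) (toℚᵘ-ι (+ suc k * x)) ⟩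
    mkℚᵘ (+ 1) k ℚᵘ.* mkℚᵘ (+ suc k * x) 0                    ≈⟨ *≡* (cancel (+ suc k) x) ⟩
    mkℚᵘ x 0                                                  ≈⟨ toℚᵘ-ι x ⟨
    toℚᵘ (ι x)                                                ∎)
    where
    cancel : ∀ n x → 1ℤ * (n * x) * 1ℤ ≡ x * (n * 1ℤ)
    cancel = solve-∀

module Evaluation where

  open import Data.Integer using (+_; _-_; _*_; _^_; 1ℤ; -1ℤ)
  import Data.Rational as ℚ
  open Coefficients
  open Embedding
  open ≡-Reasoning

  ι-homo-cross : ∀ a b c d → ι (a * b - c * d) ≡ ι a ℚ.* ι b ℚ.- ι c ℚ.* ι d
  ι-homo-cross a b c d = trans (ι-homo-- (a * b) (c * d)) (cong₂ ℚ._-_ (ι-homo-* a b) (ι-homo-* c d))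

  v-solution : ∀ {D t f} → Recurrence D t f → f 0 ≡ 1ℤ → ∀ i → v D i (ι t) ≡ ι (f i)
  v-solution rec f0≡1 zero       = cong ι (sym f0≡1)
  v-solution rec f0≡1 (suc zero) = cong ι (sym (recurrence-first rec f0≡1))
  v-solution {D} {t} {f} rec f0≡1 (suc (suc i)) = begin
    v D (suc (suc i)) (ι t)
      ≡⟨ cong₂ (λ a b → c ℚ.* (ι t ℚ.* a ℚ.- ι (+ D - + i) ℚ.* b)) (v-solution rec f0≡1 (suc i)) (v-solution rec f0≡1 i) ⟩
    c ℚ.* (ι t ℚ.* ι (f (suc i)) ℚ.- ι (+ D - + i) ℚ.* ι (f i))
      ≡⟨ cong (c ℚ.*_) (ι-homo-cross t (f (suc i)) (+ D - + i) (f i)) ⟨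
    c ℚ.* ι (t * f (suc i) - (+ D - + i) * f i)
      ≡⟨ cong (λ z → c ℚ.* ι z) (recurrence-next rec i) ⟩
    c ℚ.* ι (+ suc (suc i) * f (suc (suc i)))
      ≡⟨ 1/n*ι[n*x]≡ιx (suc i) (f (suc (suc i))) ⟩
    ι (f (suc (suc i)))
      ∎
    where
    c = + 1 ℚ./ suc (suc i)

  v-krawtchouk-penultimate : ∀ m n k → n ℕ.+ m ≡ suc k → v (suc k) k (ι (+ m - + n)) ≡ ι (-1ℤ ^ n * (+ m - + n))
  v-krawtchouk-penultimate m n k n+m≡1+k = begin
    v (suc k) k (ι (+ m - + n)) ≡⟨ v-solution rec (krawtchouk-constant m n) k ⟩
    ι (krawtchouk m n k)        ≡⟨ cong ι (krawtchouk-penultimate m n k n+m≡1+k) ⟩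
    ι (-1ℤ ^ n * (+ m - + n))   ∎
    where
    rec : Recurrence (suc k) (+ m - + n) (krawtchouk m n)
    rec = subst (λ D → Recurrence D (+ m - + n) (krawtchouk m n)) n+m≡1+k (krawtchouk-recurrence m n)

open Coefficients using ([n+m]-2n≡m-n)
open Evaluation using (v-krawtchouk-penultimate)
open import Data.Nat using (ℕ; _≤_; _∸_; _*_)
open import Data.Integer using (+_; -_; _^_; _-_)

-- 3 ≤ D only serves to exclude D = 0, where D ∸ 1 truncates to 0.
lemma4p3 : (D : ℕ) → 3 ≤ D → (n : ℕ) → n ≤ D →
    v D (D ∸ 1) (ι ((+ D) - (+ (2 * n)))) ≡ ι (((- (+ 1)) ^ n) Data.Integer.* ((+ D) - (+ (2 * n))))
lemma4p3 (suc k) _ n n≤D =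
  subst (λ t → v (suc k) k (ι t) ≡ ι (((- (+ 1)) ^ n) Data.Integer.* t)) (sym node)
    (v-krawtchouk-penultimate m n k n+m≡D)
  where
  m = suc k ∸ n
  n+m≡D : n ℕ.+ m ≡ suc k
  n+m≡D = ℕ.m+[n∸m]≡n n≤D
  node : + suc k - + (2 * n) ≡ + m - + n
  node = subst (λ D → + D - + (2 * n) ≡ + m - + n) n+m≡D ([n+m]-2n≡m-n n m)
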